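{- For all integers $a,b\ge0$, except the cases $a=b=0$ and $a=b=1$, one has $\phi^a\dagger\phi^b=\phi^a+\phi^b$.
   Context: Let $\phi=\frac{1+\sqrt5}{2}$ and $\psi=1/\phi$. The Fibonacci words over $\{A,B\}$ are $w_1=A$, $w_2=AB$, $w_{n+2}=w_{n+1}w_n$; the infinite Fibonacci word $c_1c_2c_3\cdots=ABAABABAAB\cdots$ is their common extension. With $v(A)=1$, $v(B)=\psi$, set $p_0=0$ and $p_m=\sum_{i=1}^m v(c_i)$ for $m\ge1$; the values $p_m$ are strictly increasing in $m$, and every $\phi^a$ ($a\ge0$) equals some $p_m$. Phinary addition $\dagger$ is defined on $\{p_m:m\ge0\}$ by $p_i\dagger p_j=p_{i+j}$ (i.e. it is ordinary addition of the indices in this ordered list). -}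

module Defs where

open import Data.Nat using (ℕ; zero; suc)
open import Data.Integer using (ℤ; +_; -[1+_]) renaming (_+_ to _+ℤ_)
open import Data.List using (List; []; _∷_; _++_)
open import Data.Product using (_×_; _,_)

data Letter : Set where
  A B : Letter

-- Fibonacci words: w 1 = A, w 2 = AB, w (n+2) = w (n+1) w n.
-- (w 0 is an unused dummy value.)
w : ℕ → List Letter
w zero = []
w (suc zero) = A ∷ []
w (suc (suc zero)) = A ∷ B ∷ []
w (suc (suc (suc n))) = w (suc (suc n)) ++ w (suc n)

-- i-th letter (1-indexed) of a list, with a default value when out of range
nth : List Letter → ℕ → Letter
nth []       _             = A
nth (x ∷ xs) zero          = A
nth (x ∷ xs) (suc zero)    = x
nth (x ∷ xs) (suc (suc i)) = nth xs (suc i)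

-- The infinite Fibonacci word c₁c₂c₃⋯ : c i is the i-th letter of w i
-- (|w i| ≥ i for i ≥ 1 and each w n is a prefix of w (n+1), so this is the
-- common extension).  c 0 is an unused dummy value.
c : ℕ → Letter
c i = nth (w i) i

-- The ring ℤ[φ]: the pair (x , y) represents the real number x + y·φ.
-- Since φ is irrational, this representation is unique, so equality of
-- real numbers of this form is equality of pairs.
ℤφ : Set
ℤφ = ℤ × ℤ

zeroφ : ℤφ
zeroφ = (+ 0 , + 0)

oneφ : ℤφ
oneφ = (+ 1 , + 0)

_⊕_ : ℤφ → ℤφ → ℤφ
(x , y) ⊕ (x' , y') = (x +ℤ x' , y +ℤ y')

-- multiplication by φ, using φ² = φ + 1:  φ(x + yφ) = y + (x + y)φ
mulφ : ℤφ → ℤφ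
mulφ (x , y) = (y , x +ℤ y)

φ^ : ℕ → ℤφ
φ^ zero    = oneφ
φ^ (suc a) = mulφ (φ^ a)

-- ψ = 1/φ = φ - 1
ψ : ℤφ
ψ = (-[1+ 0 ] , + 1)

v : Letter → ℤφ
v A = oneφ
v B = ψ

p : ℕ → ℤφ
p zero    = zeroφ
p (suc m) = p m ⊕ v (c (suc m))

module Submission where

open import Defs
open import Data.Nat using (ℕ; zero; suc; _+_; _∸_; _≤_; _<_; z≤n; s≤s)
open import Data.Nat.Properties
  using (≤-trans; ≤-reflexive; ≤-total; <-cmp; m≤m+n; +-mono-≤; m∸n+n≡m; n≤1+n)
import Data.Nat.Properties as ℕ
open import Data.Integer using (ℤ; +_) renaming (_+_ to _+ℤ_)
import Data.Integer.Properties as ℤ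
open import Data.Integer.Solver using (module +-*-Solver)
open import Data.List using (List; []; _∷_; _++_; length; take)
open import Data.List.Properties using (length-++; ++-assoc; ++-identityʳ)
open import Data.Product using (_×_; _,_; ∃)
open import Data.Sum using (inj₁; inj₂)
open import Data.Empty using (⊥-elim)
open import Relation.Nullary using (¬_)
open import Relation.Binary.Definitions using (tri<; tri≈; tri>)
open import Relation.Binary.PropositionalEquality
  using (_≡_; refl; sym; trans; cong; cong₂; subst; module ≡-Reasoning)

-- Let L a = |w (a+1)|.  The word w (a+1) has value φ^a, and it
-- is a prefix of the infinite word, so p (L a) = φ^a.  More generally
-- p (length xs) = val xs for every prefix xs of some Fibonacci word
-- (`p-prefix`).  The map x + yφ ↦ x + 2y counts letters, so p is injective
-- and the hypotheses force i = L a, j = L b.  It therefore suffices to show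
-- that the concatenation w (a+1) w (b+1) is itself a prefix of some
-- Fibonacci word, since then p (L a + L b) = φ^a ⊕ φ^b (`p-concat`).  For
-- a > b this holds because w (a+2) = w (a+1) w a and w (b+1) ⊑ w a; for
-- a = b ≥ 2 because w (a+1) w (a+1) ⊑ w (a+3).  (For a = b ∈ {0,1} it
-- genuinely fails: neither AA nor ABAB is a prefix of ABAABABA⋯.)

⊕-assoc : ∀ x y z → (x ⊕ y) ⊕ z ≡ x ⊕ (y ⊕ z)
⊕-assoc (x , x') (y , y') (z , z') = cong₂ _,_ (ℤ.+-assoc x y z) (ℤ.+-assoc x' y' z')

⊕-comm : ∀ x y → x ⊕ y ≡ y ⊕ x
⊕-comm (x , x') (y , y') = cong₂ _,_ (ℤ.+-comm x y) (ℤ.+-comm x' y')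

⊕-identityˡ : ∀ x → zeroφ ⊕ x ≡ x
⊕-identityˡ (x , x') = cong₂ _,_ (ℤ.+-identityˡ x) (ℤ.+-identityˡ x')

⊕-identityʳ : ∀ x → x ⊕ zeroφ ≡ x
⊕-identityʳ (x , x') = cong₂ _,_ (ℤ.+-identityʳ x) (ℤ.+-identityʳ x')

-- φ^(n+2) = φ^(n+1) + φ^n, the recursion mirrored by w (n+3) = w (n+2) w (n+1).
φ^-recursion : ∀ n → φ^ (suc (suc n)) ≡ φ^ (suc n) ⊕ φ^ n
φ^-recursion n with φ^ n
... | (x , y) = cong₂ _,_ (ℤ.+-comm x y) (ℤ.+-comm y (x +ℤ y))

val : List Letter → ℤφ
val []       = zeroφ
val (x ∷ xs) = v x ⊕ val xs

val-++ : ∀ xs ys → val (xs ++ ys) ≡ val xs ⊕ val ys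
val-++ []       ys = sym (⊕-identityˡ (val ys))
val-++ (x ∷ xs) ys =
  trans (cong (v x ⊕_) (val-++ xs ys)) (sym (⊕-assoc (v x) (val xs) (val ys)))

val-take-suc : ∀ W m → suc m ≤ length W →
  val (take (suc m) W) ≡ val (take m W) ⊕ v (nth W (suc m))
val-take-suc (x ∷ xs) zero    _ = trans (⊕-identityʳ (v x)) (sym (⊕-identityˡ (v x)))
val-take-suc (x ∷ xs) (suc m) (s≤s m<|xs|) =
  trans (cong (v x ⊕_) (val-take-suc xs m m<|xs|))
        (sym (⊕-assoc (v x) (val (take m xs)) (v (nth xs (suc m)))))

infix 4 _⊑_

_⊑_ : List Letter → List Letter → Set
xs ⊑ ys = ∃ λ zs → ys ≡ xs ++ zs

⊑-++ : ∀ xs ys → xs ⊑ xs ++ ys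
⊑-++ xs ys = ys , refl

⊑-trans : ∀ {xs ys zs} → xs ⊑ ys → ys ⊑ zs → xs ⊑ zs
⊑-trans {xs} (us , refl) (us' , refl) = us ++ us' , ++-assoc xs us us'

⊑-prepend : ∀ xs {ys zs} → ys ⊑ zs → xs ++ ys ⊑ xs ++ zs
⊑-prepend xs {ys} (us , refl) = us , sym (++-assoc xs ys us)

⊑-length : ∀ {xs ys} → xs ⊑ ys → length xs ≤ length ys
⊑-length {xs} (us , refl) =
  ≤-trans (m≤m+n (length xs) (length us)) (≤-reflexive (sym (length-++ xs)))

⊑-take : ∀ {xs ys} → xs ⊑ ys → take (length xs) ys ≡ xs
⊑-take {[]}     _          = refl
⊑-take {x ∷ xs} (us , refl) = cong (x ∷_) (⊑-take (us , refl))

nth-zero : ∀ xs → nth xs 0 ≡ A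
nth-zero []      = refl
nth-zero (_ ∷ _) = refl

nth-⊑ : ∀ {xs ys} i → xs ⊑ ys → i ≤ length xs → nth xs i ≡ nth ys i
nth-⊑ {[]}     zero          (us , refl) _ = sym (nth-zero us)
nth-⊑ {x ∷ xs} zero          (us , refl) _ = refl
nth-⊑ {x ∷ xs} (suc zero)    (us , refl) _ = refl
nth-⊑ {x ∷ xs} (suc (suc i)) (us , refl) (s≤s i<|xs|) = nth-⊑ {xs} (suc i) (us , refl) i<|xs|

w-⊑-next : ∀ n → w (suc n) ⊑ w (suc (suc n))
w-⊑-next zero    = B ∷ [] , refl
w-⊑-next (suc n) = ⊑-++ (w (suc (suc n))) (w (suc n))

w-⊑-+ : ∀ n k → w (suc n) ⊑ w (suc (k + n))
w-⊑-+ n zero    = [] , sym (++-identityʳ _)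
w-⊑-+ n (suc k) = ⊑-trans (w-⊑-+ n k) (w-⊑-next (k + n))

w-⊑ : ∀ {n m} → n ≤ m → w (suc n) ⊑ w (suc m)
w-⊑ {n} {m} n≤m = subst (λ t → w (suc n) ⊑ w (suc t)) (m∸n+n≡m n≤m) (w-⊑-+ n (m ∸ n))

w-length : ∀ n → suc n ≤ length (w (suc n))
w-length zero          = s≤s z≤n
w-length (suc zero)    = s≤s (s≤s z≤n)
w-length (suc (suc n)) = begin
  suc (suc (suc n))                  ≡⟨ ℕ.+-comm 1 (suc (suc n)) ⟩
  suc (suc n) + 1                    ≤⟨ +-mono-≤ (w-length (suc n)) (≤-trans (s≤s z≤n) (w-length n)) ⟩
  length W₂ + length W₁              ≡⟨ sym (length-++ W₂) ⟩
  length (w (suc (suc (suc n))))     ∎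
  where
  open ℕ.≤-Reasoning
  W₂ = w (suc (suc n))
  W₁ = w (suc n)

c-agrees : ∀ n i → i ≤ length (w (suc n)) → c i ≡ nth (w (suc n)) i
c-agrees n zero    _ = sym (nth-zero (w (suc n)))
c-agrees n (suc i) i<|w| with ≤-total i n
... | inj₁ i≤n = nth-⊑ (suc i) (w-⊑ i≤n) (w-length i)
... | inj₂ n≤i = sym (nth-⊑ (suc i) (w-⊑ n≤i) i<|w|)

val-w : ∀ a → val (w (suc a)) ≡ φ^ a
val-w zero          = refl
val-w (suc zero)    = refl
val-w (suc (suc a)) = begin
  val (w (suc (suc a)) ++ w (suc a))      ≡⟨ val-++ (w (suc (suc a))) (w (suc a)) ⟩
  val (w (suc (suc a))) ⊕ val (w (suc a)) ≡⟨ cong₂ _⊕_ (val-w (suc a)) (val-w a) ⟩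
  φ^ (suc a) ⊕ φ^ a                       ≡⟨ sym (φ^-recursion a) ⟩
  φ^ (suc (suc a))                        ∎
  where open ≡-Reasoning

p-take : ∀ n m → m ≤ length (w (suc n)) → p m ≡ val (take m (w (suc n)))
p-take n zero    _ = refl
p-take n (suc m) m<|w| =
  trans (cong₂ _⊕_ (p-take n m (≤-trans (n≤1+n m) m<|w|)) (cong v (c-agrees n (suc m) m<|w|)))
        (sym (val-take-suc (w (suc n)) m m<|w|))

p-prefix : ∀ {xs} n → xs ⊑ w (suc n) → p (length xs) ≡ val xs
p-prefix {xs} n xs⊑w = trans (p-take n (length xs) (⊑-length xs⊑w)) (cong val (⊑-take xs⊑w))

L : ℕ → ℕ
L a = length (w (suc a))

p-L : ∀ a → p (L a) ≡ φ^ a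
p-L a = trans (p-prefix a ([] , sym (++-identityʳ _))) (val-w a)

-- Injectivity of p: the additive map x + yφ ↦ x + 2y sends every letter
-- value to 1, so it sends p m to m.

weight : ℤφ → ℤ
weight (x , y) = x +ℤ (y +ℤ y)

weight-⊕ : ∀ s t → weight (s ⊕ t) ≡ weight s +ℤ weight t
weight-⊕ (x , y) (x' , y') =
  solve 4 (λ x y x' y' → (x :+ x') :+ ((y :+ y') :+ (y :+ y'))
                      := (x :+ (y :+ y)) :+ (x' :+ (y' :+ y'))) refl x y x' y'
  where open +-*-Solver

weight-v : ∀ l → weight (v l) ≡ + 1
weight-v A = refl
weight-v B = refl

weight-p : ∀ m → weight (p m) ≡ + m
weight-p zero    = refl
weight-p (suc m) = begin
  weight (p m ⊕ v (c (suc m)))         ≡⟨ weight-⊕ (p m) (v (c (suc m))) ⟩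
  weight (p m) +ℤ weight (v (c (suc m))) ≡⟨ cong₂ _+ℤ_ (weight-p m) (weight-v (c (suc m))) ⟩
  + (m + 1)                              ≡⟨ cong +_ (ℕ.+-comm m 1) ⟩
  + suc m                                ∎
  where open ≡-Reasoning

p-injective : ∀ {i j} → p i ≡ p j → i ≡ j
p-injective {i} {j} eq = ℤ.+-injective (trans (sym (weight-p i)) (trans (cong weight eq) (weight-p j)))

p-concat : ∀ a b n → w (suc a) ++ w (suc b) ⊑ w (suc n) → p (L a + L b) ≡ φ^ a ⊕ φ^ b
p-concat a b n concat⊑w = begin
  p (L a + L b)                         ≡⟨ cong p (sym (length-++ (w (suc a)))) ⟩
  p (length (w (suc a) ++ w (suc b)))   ≡⟨ p-prefix n concat⊑w ⟩
  val (w (suc a) ++ w (suc b))          ≡⟨ val-++ (w (suc a)) (w (suc b)) ⟩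
  val (w (suc a)) ⊕ val (w (suc b))     ≡⟨ cong₂ _⊕_ (val-w a) (val-w b) ⟩
  φ^ a ⊕ φ^ b                           ∎
  where open ≡-Reasoning

-- For b < a: w (a+2) = w (a+1) w a and w (b+1) ⊑ w a.
w-concat-< : ∀ {a b} → b < a → w (suc a) ++ w (suc b) ⊑ w (suc (suc a))
w-concat-< {suc a} (s≤s b≤a) = ⊑-prepend (w (suc (suc a))) (w-⊑ b≤a)

-- For a ≥ 2, with X = w (a+1) = w a w (a-1): w (a+3) = X w a X, and
-- X = w a w (a-1) ⊑ w a X because w (a-1) ⊑ w a ⊑ X.
w-concat-≡ : ∀ k → w (suc (suc (suc k))) ++ w (suc (suc (suc k))) ⊑ w (suc (suc (suc (suc (suc k)))))
w-concat-≡ k = subst (X ++ X ⊑_) (sym (++-assoc X W₂ X)) (⊑-prepend X (⊑-prepend W₂ W₁⊑X))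
  where
  W₁ = w (suc k)
  W₂ = w (suc (suc k))
  X  = w (suc (suc (suc k)))
  W₁⊑X : W₁ ⊑ X
  W₁⊑X = ⊑-trans (w-⊑-next k) (⊑-++ W₂ W₁)

φ^-dagger : (a b : ℕ) → ¬ (a ≡ 0 × b ≡ 0) → ¬ (a ≡ 1 × b ≡ 1) → p (L a + L b) ≡ φ^ a ⊕ φ^ b
φ^-dagger a b not00 not11 with <-cmp a b
... | tri< a<b _ _ = begin
  p (L a + L b)  ≡⟨ cong p (ℕ.+-comm (L a) (L b)) ⟩
  p (L b + L a)  ≡⟨ p-concat b a (suc b) (w-concat-< a<b) ⟩
  φ^ b ⊕ φ^ a    ≡⟨ ⊕-comm (φ^ b) (φ^ a) ⟩
  φ^ a ⊕ φ^ b    ∎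
  where open ≡-Reasoning
... | tri> _ _ b<a = p-concat a b (suc a) (w-concat-< b<a)
φ^-dagger zero          .zero          not00 _     | tri≈ _ refl _ = ⊥-elim (not00 (refl , refl))
φ^-dagger (suc zero)    .(suc zero)    _     not11 | tri≈ _ refl _ = ⊥-elim (not11 (refl , refl))
φ^-dagger (suc (suc k)) .(suc (suc k)) _     _     | tri≈ _ refl _ =
  p-concat (suc (suc k)) (suc (suc k)) (suc (suc (suc (suc k)))) (w-concat-≡ k)

mainTheorem11 : (a b : ℕ) → ¬ (a ≡ 0 × b ≡ 0) → ¬ (a ≡ 1 × b ≡ 1) →
    (i j : ℕ) → p i ≡ φ^ a → p j ≡ φ^ b → p (i + j) ≡ φ^ a ⊕ φ^ b
mainTheorem11 a b not00 not11 i j pᵢ≡φ^a pⱼ≡φ^b = begin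
  p (i + j)      ≡⟨ cong₂ (λ s t → p (s + t)) i≡La j≡Lb ⟩
  p (L a + L b)  ≡⟨ φ^-dagger a b not00 not11 ⟩
  φ^ a ⊕ φ^ b    ∎
  where
  open ≡-Reasoning
  i≡La : i ≡ L a
  i≡La = p-injective (trans pᵢ≡φ^a (sym (p-L a)))
  j≡Lb : j ≡ L b
  j≡Lb = p-injective (trans pⱼ≡φ^b (sym (p-L b)))
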